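{- Let $G$ and $H$ be connected simple graphs on at least two vertices such that $\chi''_a(G)\leq\Delta(G)+3$ and $\chi''_a(H)\leq\Delta(H)+3$. If $\Delta(H)=\Delta(G)+1$, then $\chi''_a(G\circ H)\leq\Delta(G\circ H)+3$.
   Context: All graphs are finite and simple; $\Delta(\cdot)$ denotes maximum degree and $[k]=\{1,\ldots,k\}$. A proper total $k$-coloring of $G=(V,E)$ is a map $f:V\cup E\to[k]$ such that adjacent vertices get different colors, adjacent edges get different colors, and each edge gets a color different from the colors of its endvertices. The color set of $v$ is $C_f(v)=\{f(v)\}\cup\{f(vu): vu\in E\}$. An adjacent vertex distinguishing (avd) total $k$-coloring is a proper total $k$-coloring with $C_f(u)\neq C_f(v)$ for every edge $uv$; $\chi''_a(G)$ is the least such $k$. The corona $G\circ H$ is obtained from one copy of $G$ and $|V(G)|$ disjoint copies of $H$, one for each vertex $v$ of $G$, by joining each vertex $v$ of $G$ to every vertex of its copy of $H$. -}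

module Defs where

open import Data.Nat using (ℕ; zero; suc; _+_; _*_; _≤_; _⊔_)
open import Data.Bool using (Bool; true; false; _∧_; if_then_else_)
open import Data.Fin using (Fin; splitAt; remQuot)
open import Data.Fin.Properties using (_≟_)
open import Data.List using (List; length; filterᵇ; allFin; map; foldr)
open import Data.Sum using (_⊎_; inj₁; inj₂)
open import Data.Product using (Σ; _×_; _,_; ∃)
open import Relation.Nullary using (¬_; does)
open import Relation.Binary.PropositionalEquality using (_≡_; _≢_)
open import Function.Bundles using (_⇔_)

record Graph : Set where
  constructor mkGraph
  field
    n   : ℕ
    adj : Fin n → Fin n → Bool
open Graph public

Adj : (G : Graph) → Fin (n G) → Fin (n G) → Set
Adj G u v = adj G u v ≡ true

IsSimple : Graph → Set
IsSimple G = (∀ u v → adj G u v ≡ adj G v u) × (∀ u → adj G u u ≡ false)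

data Walk (G : Graph) : Fin (n G) → Fin (n G) → Set where
  here : ∀ {u} → Walk G u u
  step : ∀ {u v w} → Adj G u v → Walk G v w → Walk G u w

Connected : Graph → Set
Connected G = ∀ u v → Walk G u v

deg : (G : Graph) → Fin (n G) → ℕ
deg G v = length (filterᵇ (adj G v) (allFin (n G)))

Δ : Graph → ℕ
Δ G = foldr _⊔_ 0 (map (deg G) (allFin (n G)))

-- Edge colors are given by a function on ordered pairs; only values on
-- adjacent pairs matter, and symmetry on edges is required below.
record TotalColoring (G : Graph) (k : ℕ) : Set where
  constructor mkTC
  field
    vcol : Fin (n G) → Fin k
    ecol : Fin (n G) → Fin (n G) → Fin k
open TotalColoring public

IsProperTotal : (G : Graph) (k : ℕ) → TotalColoring G k → Set
IsProperTotal G k f =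
    (∀ u v → Adj G u v → ecol f u v ≡ ecol f v u)
  × (∀ u v → Adj G u v → vcol f u ≢ vcol f v)
  × (∀ u v w → Adj G u v → Adj G u w → v ≢ w → ecol f u v ≢ ecol f u w)
  × (∀ u v → Adj G u v → ecol f u v ≢ vcol f u)

InColorSet : (G : Graph) (k : ℕ) → TotalColoring G k → Fin (n G) → Fin k → Set
InColorSet G k f v c = (vcol f v ≡ c) ⊎ (Σ (Fin (n G)) λ u → Adj G v u × (ecol f v u ≡ c))

IsAVDTotal : (G : Graph) (k : ℕ) → TotalColoring G k → Set
IsAVDTotal G k f = IsProperTotal G k f
  × (∀ u v → Adj G u v → ¬ (∀ c → InColorSet G k f u c ⇔ InColorSet G k f v c))

HasAVDTotalColoring : Graph → ℕ → Set
HasAVDTotalColoring G k = Σ (TotalColoring G k) (IsAVDTotal G k)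

-- χ''_a(G) ≤ m : the least k admitting an avd total k-coloring is ≤ m,
-- i.e. some k ≤ m admits an avd total k-coloring.
χa≤ : Graph → ℕ → Set
χa≤ G m = Σ ℕ λ k → k ≤ m × HasAVDTotalColoring G k

-- Corona G ∘ H: vertices Fin (nG + nG * nH); the first nG are G's vertices,
-- vertex nG + (i*nH + j) (decoded via remQuot) is vertex j of the copy of H at i.
coronaAdj : (G H : Graph) → Fin (n G + n G * n H) → Fin (n G + n G * n H) → Bool
coronaAdj G H x y with splitAt (n G) x | splitAt (n G) y
... | inj₁ a | inj₁ b = adj G a b
... | inj₁ a | inj₂ q with remQuot {n G} (n H) q
...   | c , _ = does (a ≟ c)
coronaAdj G H x y | inj₂ p | inj₁ b with remQuot {n G} (n H) p
...   | c , _ = does (c ≟ b)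
coronaAdj G H x y | inj₂ p | inj₂ q with remQuot {n G} (n H) p | remQuot {n G} (n H) q
...   | c , h | c' , h' = does (c ≟ c') ∧ adj H h h'

corona : Graph → Graph → Graph
corona G H = mkGraph (n G + n G * n H) (coronaAdj G H)

-- Let D = Δ G. Color G ∘ H with the D + 3 colors of an avd coloring of G plus one new color
-- ν j for every vertex j of H, i.e. with D + 3 + |H| ≤ Δ (G ∘ H) + 3 colors. The graph G keeps
-- its coloring, the spoke from a root v to the copy of j gets ν j, and the copy of H at v gets a
-- proper total (D + 4)-coloring of H in which two colors a, b are renamed ν j₀, ν j₁ and the other
-- D + 2 colors are sent injectively into G's colors, avoiding the color of v. Adjacent roots are
-- then separated by G's colors, a root and a vertex of its copy by the root's color, and adjacent
-- vertices i, j of a copy by ν i, unless {i, j} = {j₀, j₁}. For that pair, a is missing at j₀ and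
-- b at j₁, and since every vertex of H misses two of the D + 4 colors they can be chosen so that
-- C(j₀) ∪ {a} ≠ C(j₁) ∪ {b}.
{-# OPTIONS --safe #-}
module Submission where

open import Defs
open import Data.Nat using (ℕ; suc; _+_; _≤_)
open import Relation.Binary.PropositionalEquality using (_≡_)

open import Data.Nat using (zero; _*_; _<_; _⊔_; z≤n; s≤s)
open import Data.Nat.Properties
  using (≤-trans; ≤-reflexive; n≤1+n; +-comm; +-monoˡ-≤; +-monoʳ-≤; ⊔-sel;
         m≤n⇒m≤n⊔o; m≤n⇒m≤o⊔n; module ≤-Reasoning)
open import Data.Bool using (Bool; true; false; _∧_; T?)
open import Data.Bool.Properties using (T-≡; ∧-conicalˡ; ∧-conicalʳ)
open import Data.Fin
  using (Fin; zero; suc; fromℕ<; splitAt; join; combine; remQuot; _↑ˡ_; _↑ʳ_; punchIn; punchOut)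
open import Data.Fin.Properties
  using (_≟_; +↔⊎; *↔×; inject≤-injective; splitAt-join; combine-injectiveʳ;
         punchIn-injective; punchInᵢ≢i; punchOut-injective; pigeonhole; ¬∀⟶∃¬; injective⇒≤; <-irrefl)
open import Data.List using (List; _∷_; length; map; filterᵇ; allFin; tabulate)
open import Data.List.Properties using (length-map; foldr-preservesᵒ)
open import Data.List.Membership.Propositional using (_∈_; _∉_)
open import Data.List.Membership.Propositional.Properties
  using (∈-map⁺; ∈-map⁻; ∈-filter⁺; ∈-filter⁻; ∈-allFin; foldr-selective)
import Data.List.Membership.Setoid.Properties as SetoidMembership
open import Data.List.Relation.Unary.Any as Any using (here; there)
open import Data.Sum using (_⊎_; inj₁; inj₂; [_,_]′)
open import Data.Sum.Properties using (inj₁-injective; inj₂-injective)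
open import Data.Sum.Function.Propositional using (_⊎-↔_; _⊎-⇔_)
open import Data.Product using (Σ; ∃; ∃₂; _×_; _,_; proj₁; proj₂)
open import Data.Empty using (⊥-elim)
open import Function using (_∘_; id)
open import Function.Bundles using (_⇔_; _↔_; mk⇔; Equivalence; Inverse; Injection)
open import Function.Definitions using (Injective)
open import Function.Properties.Inverse using (Inverse⇒Injection)
open import Function.Construct.Identity using (↔-id; ⇔-id)
open import Function.Construct.Composition using (_↔-∘_; _⇔-∘_)
open import Function.Construct.Symmetry using (⇔-sym)
open import Relation.Binary.PropositionalEquality
  using (_≢_; refl; sym; trans; cong; cong₂; subst; subst₂; setoid)
open import Relation.Nullary using (¬_; Dec; yes; no; does; contradiction)
open import Relation.Nullary.Decidable using (dec-true; _⊎-dec_)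
import Relation.Nullary.Decidable as Dec
open import Relation.Unary using (Decidable)

open Equivalence using (to; from)

-- For V = Fin (n G) and _∼_ = Adj G these are definitionally IsProperTotal and IsAVDTotal.
module _ {V C : Set} (_∼_ : V → V → Set) (vc : V → C) (ec : V → V → C) where

  IsProper : Set
  IsProper = (∀ u v → u ∼ v → ec u v ≡ ec v u)
           × (∀ u v → u ∼ v → vc u ≢ vc v)
           × (∀ u v w → u ∼ v → u ∼ w → v ≢ w → ec u v ≢ ec u w)
           × (∀ u v → u ∼ v → ec u v ≢ vc u)

  ColorSet : V → C → Set
  ColorSet v c = (vc v ≡ c) ⊎ Σ V λ u → v ∼ u × ec v u ≡ c

  SameColors : V → V → Set
  SameColors u v = ∀ c → ColorSet u c ⇔ ColorSet v c

  IsAVD : Set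
  IsAVD = IsProper × (∀ u v → u ∼ v → ¬ SameColors u v)

module Proper {V C : Set} {_∼_ : V → V → Set} {vc : V → C} {ec : V → V → C}
              (proper : IsProper _∼_ vc ec) where

  ec-sym : ∀ u v → u ∼ v → ec u v ≡ ec v u
  ec-sym = proj₁ proper

  vc-distinct : ∀ u v → u ∼ v → vc u ≢ vc v
  vc-distinct = proj₁ (proj₂ proper)

  ec-distinct : ∀ u v w → u ∼ v → u ∼ w → v ≢ w → ec u v ≢ ec u w
  ec-distinct = proj₁ (proj₂ (proj₂ proper))

  ec≢vc : ∀ u v → u ∼ v → ec u v ≢ vc u
  ec≢vc = proj₂ (proj₂ (proj₂ proper))

  ∼⇒≢ : ∀ {u v} → u ∼ v → u ≢ v
  ∼⇒≢ u∼v u≡v = vc-distinct _ _ u∼v (cong vc u≡v)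

¬∀⇔ : ∀ {A : Set} {P Q : A → Set} x → P x → ¬ Q x → ¬ (∀ x → P x ⇔ Q x)
¬∀⇔ x px ¬qx P⇔Q = ¬qx (to (P⇔Q x) px)

module _ {V W C D : Set} {_∼_ : V → V → Set} {_≈_ : W → W → Set}
         (φ : W ↔ V) (≈⇔∼ : ∀ x y → x ≈ y ⇔ Inverse.to φ x ∼ Inverse.to φ y)
         {ι : C → D} (ι-injective : Injective _≡_ _≡_ ι)
         {vc : V → C} {ec : V → V → C} where

  open Inverse φ using () renaming (to to φ⁺; from to φ⁻; strictlyInverseˡ to φ⁺∘φ⁻)

  private
    vc′ : W → D
    vc′ = ι ∘ vc ∘ φ⁺

    ec′ : W → W → D
    ec′ x y = ι (ec (φ⁺ x) (φ⁺ y))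

    φ⁺-injective : Injective _≡_ _≡_ φ⁺
    φ⁺-injective = Injection.injective (Inverse⇒Injection φ)

  relabel-proper : IsProper _∼_ vc ec → IsProper _≈_ vc′ ec′
  relabel-proper proper =
    (λ x y x≈y → cong ι (ec-sym _ _ (to (≈⇔∼ x y) x≈y))) ,
    (λ x y x≈y → vc-distinct _ _ (to (≈⇔∼ x y) x≈y) ∘ ι-injective) ,
    (λ x y z x≈y x≈z y≢z → ec-distinct _ _ _ (to (≈⇔∼ x y) x≈y) (to (≈⇔∼ x z) x≈z)
                                          (y≢z ∘ φ⁺-injective) ∘ ι-injective) ,
    (λ x y x≈y → ec≢vc _ _ (to (≈⇔∼ x y) x≈y) ∘ ι-injective)
    where open Proper proper

  ColorSet-relabel : ∀ {x c} → ColorSet _≈_ vc′ ec′ x (ι c) ⇔ ColorSet _∼_ vc ec (φ⁺ x) c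
  ColorSet-relabel {x} = mk⇔ forth back
    where
    forth : ∀ {c} → ColorSet _≈_ vc′ ec′ x (ι c) → ColorSet _∼_ vc ec (φ⁺ x) c
    forth (inj₁ e) = inj₁ (ι-injective e)
    forth (inj₂ (y , x≈y , e)) = inj₂ (φ⁺ y , to (≈⇔∼ x y) x≈y , ι-injective e)

    back : ∀ {c} → ColorSet _∼_ vc ec (φ⁺ x) c → ColorSet _≈_ vc′ ec′ x (ι c)
    back (inj₁ e) = inj₁ (cong ι e)
    back (inj₂ (t , x∼t , e)) =
      inj₂ (φ⁻ t , from (≈⇔∼ x (φ⁻ t)) (subst (φ⁺ x ∼_) (sym (φ⁺∘φ⁻ t)) x∼t) ,
            cong ι (trans (cong (ec (φ⁺ x)) (φ⁺∘φ⁻ t)) e))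

  relabel-avd : IsAVD _∼_ vc ec → IsAVD _≈_ vc′ ec′
  relabel-avd (proper , separated) =
    relabel-proper proper ,
    λ x y x≈y same → separated _ _ (to (≈⇔∼ x y) x≈y)
      λ c → ColorSet-relabel ⇔-∘ (same (ι c) ⇔-∘ ⇔-sym ColorSet-relabel)

HasAVD-relabel : ∀ {V C : Set} {_∼_ : V → V → Set} {vc : V → C} {ec : V → V → C} {k}
  (Γ : Graph) (φ : Fin (n Γ) ↔ V) → (∀ x y → Adj Γ x y ⇔ Inverse.to φ x ∼ Inverse.to φ y) →
  {ι : C → Fin k} → Injective _≡_ _≡_ ι → IsAVD _∼_ vc ec → HasAVDTotalColoring Γ k
HasAVD-relabel {vc = vc} {ec} Γ φ Adj⇔∼ {ι} ι-injective avd =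
  mkTC (ι ∘ vc ∘ Inverse.to φ) (λ x y → ι (ec (Inverse.to φ x) (Inverse.to φ y))) ,
  relabel-avd φ Adj⇔∼ ι-injective avd

HasAVD-mono : ∀ {G k k′} → k ≤ k′ → HasAVDTotalColoring G k → HasAVDTotalColoring G k′
HasAVD-mono {G} k≤k′ (_ , avd) =
  HasAVD-relabel G (↔-id _) (λ _ _ → ⇔-id _) (λ {x} {y} → inject≤-injective k≤k′ k≤k′ x y) avd

χa≤⇒HasAVD : ∀ {G k k′} → χa≤ G k → k ≤ k′ → HasAVDTotalColoring G k′
χa≤⇒HasAVD (_ , k₀≤k , col) k≤k′ = HasAVD-mono (≤-trans k₀≤k k≤k′) col

count : ∀ {A : Set} → (A → Bool) → List A → ℕ
count p xs = length (filterᵇ p xs)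

count-tabulate-cong : ∀ {A B : Set} {p : A → Bool} {q : B → Bool} {n} (f : Fin n → A) (g : Fin n → B) →
  (∀ i → p (f i) ≡ true ⇔ q (g i) ≡ true) → count p (tabulate f) ≡ count q (tabulate g)
count-tabulate-cong {n = zero} f g _ = refl
count-tabulate-cong {p = p} {q} {suc n} f g pf⇔qg with p (f zero) in pf₀ | q (g zero) in qg₀
... | true  | true  = cong suc (count-tabulate-cong (f ∘ suc) (g ∘ suc) (pf⇔qg ∘ suc))
... | false | false = count-tabulate-cong (f ∘ suc) (g ∘ suc) (pf⇔qg ∘ suc)
... | true  | false = contradiction (trans (sym qg₀) (to (pf⇔qg zero) pf₀)) λ ()
... | false | true  = contradiction (trans (sym pf₀) (from (pf⇔qg zero) qg₀)) λ ()

count-tabulate-+ : ∀ {A : Set} m {n} (p : A → Bool) (f : Fin (m + n) → A) →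
  count p (tabulate f) ≡ count p (tabulate (f ∘ (_↑ˡ n))) + count p (tabulate (f ∘ (m ↑ʳ_)))
count-tabulate-+ zero p f = refl
count-tabulate-+ (suc m) p f with p (f zero)
... | true  = cong suc (count-tabulate-+ m p (f ∘ suc))
... | false = count-tabulate-+ m p (f ∘ suc)

injective⇒≤-count : ∀ {k N} (p : Fin N → Bool) (f : Fin k → Fin N) → Injective _≡_ _≡_ f →
  (∀ i → p (f i) ≡ true) → k ≤ count p (allFin N)
injective⇒≤-count p f f-injective pf =
  injective⇒≤ λ {i} {j} → f-injective ∘ SetoidMembership.index-injective (setoid _) (f∈ i) (f∈ j)
  where
  f∈ : ∀ i → f i ∈ filterᵇ p (allFin _)
  f∈ i = ∈-filter⁺ (T? ∘ p) (∈-allFin (f i)) (from T-≡ (pf i))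

deg≤Δ : (G : Graph) (v : Fin (n G)) → deg G v ≤ Δ G
deg≤Δ G v = foldr-preservesᵒ ≤⊔ 0 _ (inj₂ (Any.map ≤-reflexive (∈-map⁺ (deg G) (∈-allFin v))))
  where
  ≤⊔ : ∀ x y → deg G v ≤ x ⊎ deg G v ≤ y → deg G v ≤ x ⊔ y
  ≤⊔ x y = [ m≤n⇒m≤n⊔o y , m≤n⇒m≤o⊔n x ]′

Δ-attained : (G : Graph) → 0 < n G → ∃ λ v → Δ G ≤ deg G v
Δ-attained G 0<n with foldr-selective ⊔-sel 0 (map (deg G) (allFin (n G)))
... | inj₁ Δ≡0 = fromℕ< 0<n , ≤-trans (≤-reflexive Δ≡0) z≤n
... | inj₂ Δ∈ with ∈-map⁻ (deg G) Δ∈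
...   | v , _ , Δ≡deg = v , ≤-reflexive Δ≡deg

∃-∉ : ∀ {k} (xs : List (Fin k)) → length xs < k → ∃ λ c → c ∉ xs
∃-∉ {k} xs |xs|<k = ¬∀⟶∃¬ k (_∈ xs) (_∈? xs) not-all∈
  where
  open import Data.List.Membership.DecPropositional (_≟_ {k}) using (_∈?_)

  not-all∈ : ¬ (∀ c → c ∈ xs)
  not-all∈ all∈ with pigeonhole |xs|<k (Any.index ∘ all∈)
  ... | i , j , i<j , same-index =
    <-irrefl (SetoidMembership.index-injective (setoid _) (all∈ i) (all∈ j) same-index) i<j

module _ (G : Graph) {k : ℕ} (vc : Fin (n G) → Fin k) (ec : Fin (n G) → Fin (n G) → Fin k) where

  open import Data.List.Membership.DecPropositional (_≟_ {k}) using (_∈?_)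

  colorList : Fin (n G) → List (Fin k)
  colorList v = vc v ∷ map (ec v) (filterᵇ (adj G v) (allFin (n G)))

  ∈-colorList⇔ : ∀ {v c} → c ∈ colorList v ⇔ ColorSet (Adj G) vc ec v c
  ∈-colorList⇔ {v} = mk⇔ forth back
    where
    forth : ∀ {c} → c ∈ colorList v → ColorSet (Adj G) vc ec v c
    forth (here refl) = inj₁ refl
    forth (there c∈) with ∈-map⁻ (ec v) c∈
    ... | u , u∈ , refl =
      inj₂ (u , to T-≡ (proj₂ (∈-filter⁻ (T? ∘ adj G v) {xs = allFin (n G)} u∈)) , refl)

    back : ∀ {c} → ColorSet (Adj G) vc ec v c → c ∈ colorList v
    back (inj₁ refl) = here refl
    back (inj₂ (u , v∼u , refl)) =
      there (∈-map⁺ (ec v) (∈-filter⁺ (T? ∘ adj G v) (∈-allFin u) (from T-≡ v∼u)))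

  ColorSet? : ∀ v → Decidable (ColorSet (Adj G) vc ec v)
  ColorSet? v c = Dec.map ∈-colorList⇔ (c ∈? colorList v)

  length-colorList : ∀ v → length (colorList v) ≡ suc (deg G v)
  length-colorList v = cong suc (length-map (ec v) (filterᵇ (adj G v) (allFin (n G))))

  two-missing-colors : ∀ v → suc (suc (deg G v)) < k →
    ∃₂ λ c₁ c₂ → c₁ ≢ c₂ × ¬ ColorSet (Adj G) vc ec v c₁ × ¬ ColorSet (Adj G) vc ec v c₂
  two-missing-colors v 2+deg<k
    with c₁ , c₁∉ ← ∃-∉ (colorList v)
                         (subst (_< k) (sym (length-colorList v)) (≤-trans (n≤1+n _) 2+deg<k))
    with c₂ , c₂∉ ← ∃-∉ (c₁ ∷ colorList v)
                         (subst (_< k) (sym (cong suc (length-colorList v))) 2+deg<k)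
    = c₁ , c₂ , c₂∉ ∘ here ∘ sym , c₁∉ ∘ from ∈-colorList⇔ , c₂∉ ∘ there ∘ from ∈-colorList⇔

record SeparatingPair {k : ℕ} (S T : Fin k → Set) : Set where
  field
    a b   : Fin k
    a≢b   : a ≢ b
    a∉S   : ¬ S a
    b∉T   : ¬ T b
    apart : ¬ (∀ c → (S c ⊎ c ≡ a) ⇔ (T c ⊎ c ≡ b))

separatingPair : ∀ {k} {S T : Fin k → Set} → Decidable S → Decidable T →
  ∀ {a b₁ b₂} → ¬ S a → b₁ ≢ b₂ → ¬ T b₁ → ¬ T b₂ → SeparatingPair S T
separatingPair {S = S} {T} S? T? {a} {b₁} {b₂} a∉S b₁≢b₂ b₁∉T b₂∉T with T? a | b₁ ≟ a | S? b₂
... | no a∉T | yes b₁≡a | _ = record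
  { a = a ; b = b₂ ; a≢b = b₁≢b₂ ∘ trans b₁≡a ; a∉S = a∉S ; b∉T = b₂∉T
  ; apart = ¬∀⇔ a (inj₂ refl) [ a∉T , b₁≢b₂ ∘ trans b₁≡a ]′ }
... | no a∉T | no b₁≢a | _ = record
  { a = a ; b = b₁ ; a≢b = b₁≢a ∘ sym ; a∉S = a∉S ; b∉T = b₁∉T
  ; apart = ¬∀⇔ a (inj₂ refl) [ a∉T , b₁≢a ∘ sym ]′ }
... | yes a∈T | _ | yes b₂∈S = record
  { a = a ; b = b₁ ; a≢b = λ a≡b₁ → b₁∉T (subst T a≡b₁ a∈T) ; a∉S = a∉S ; b∉T = b₁∉T
  ; apart = ¬∀⇔ b₂ (inj₁ b₂∈S) [ b₂∉T , b₁≢b₂ ∘ sym ]′ }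
... | yes a∈T | _ | no b₂∉S = record
  { a = a ; b = b₂ ; a≢b = a≢b₂ ; a∉S = a∉S ; b∉T = b₂∉T
  ; apart = λ S⇔T → ¬∀⇔ b₂ (inj₂ refl) [ b₂∉S , a≢b₂ ∘ sym ]′ (⇔-sym ∘ S⇔T) }
  where
  a≢b₂ : a ≢ b₂
  a≢b₂ a≡b₂ = b₂∉T (subst T a≡b₂ a∈T)

missing-colors-separate : (Γ : Graph) {k : ℕ}
  (vc : Fin (n Γ) → Fin k) (ec : Fin (n Γ) → Fin (n Γ) → Fin k) → ∀ {j₀ j₁} → suc (suc (deg Γ j₀)) < k → suc (suc (deg Γ j₁)) < k →
  SeparatingPair (ColorSet (Adj Γ) vc ec j₀) (ColorSet (Adj Γ) vc ec j₁)
missing-colors-separate Γ vc ec {j₀} {j₁} j₀-room j₁-room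
  with a , _ , _ , a∉ , _ ← two-missing-colors Γ vc ec j₀ j₀-room
     | b₁ , b₂ , b₁≢b₂ , b₁∉ , b₂∉ ← two-missing-colors Γ vc ec j₁ j₁-room
  = separatingPair (ColorSet? Γ vc ec j₀) (ColorSet? Γ vc ec j₁) a∉ b₁≢b₂ b₁∉ b₂∉

does≡true⇔ : ∀ {A : Set} (a? : Dec A) → does a? ≡ true ⇔ A
does≡true⇔ (yes a) = mk⇔ (λ _ → a) (λ _ → refl)
does≡true⇔ (no ¬a) = mk⇔ (λ ()) (⊥-elim ∘ ¬a)

module Corona (G H : Graph) where

  Vertex : Set
  Vertex = Fin (n G) ⊎ (Fin (n G) × Fin (n H))

  data _∼_ : Vertex → Vertex → Set where
    base   : ∀ {u w} → Adj G u w → inj₁ u ∼ inj₁ w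
    spoke  : ∀ {v j} → inj₁ v ∼ inj₂ (v , j)
    spoke˘ : ∀ {v j} → inj₂ (v , j) ∼ inj₁ v
    copy   : ∀ {v i j} → Adj H i j → inj₂ (v , i) ∼ inj₂ (v , j)

  vertex↔ : Fin (n (corona G H)) ↔ Vertex
  vertex↔ = (↔-id _ ⊎-↔ *↔×) ↔-∘ +↔⊎

  open Inverse vertex↔ using ()
    renaming (to to decode; from to encode; strictlyInverseˡ to decode-encode)

  base⇔ : ∀ {u w} → Adj G u w ⇔ inj₁ u ∼ inj₁ w
  base⇔ = mk⇔ base λ { (base u∼w) → u∼w }

  -- coronaAdj's match on the pair remQuot q reduces by eta to projections, which a with
  -- cannot abstract; hence the helpers below take the pair as an argument.

  Adj⇔∼ : ∀ x y → Adj (corona G H) x y ⇔ decode x ∼ decode y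
  Adj⇔∼ x y with splitAt (n G) x | splitAt (n G) y
  ... | inj₁ u | inj₁ w = base⇔
  ... | inj₁ u | inj₂ q = spoke⇔ (remQuot (n H) q)
    where
    spoke⇔ : ∀ vj → does (u ≟ proj₁ vj) ≡ true ⇔ inj₁ u ∼ inj₂ vj
    spoke⇔ (v , j) = mk⇔ (λ { refl → spoke }) (λ { spoke → refl }) ⇔-∘ does≡true⇔ (u ≟ v)
  ... | inj₂ p | inj₁ w = spoke˘⇔ (remQuot (n H) p)
    where
    spoke˘⇔ : ∀ vj → does (proj₁ vj ≟ w) ≡ true ⇔ inj₂ vj ∼ inj₁ w
    spoke˘⇔ (v , j) = mk⇔ (λ { refl → spoke˘ }) (λ { spoke˘ → refl }) ⇔-∘ does≡true⇔ (v ≟ w)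
  ... | inj₂ p | inj₂ q = copy⇔ (remQuot (n H) p) (remQuot (n H) q)
    where
    copy⇔ : ∀ vi v′j →
      (does (proj₁ vi ≟ proj₁ v′j) ∧ adj H (proj₂ vi) (proj₂ v′j)) ≡ true ⇔ inj₂ vi ∼ inj₂ v′j
    copy⇔ (v , i) (v′ , j) = mk⇔ forth back
      where
      forth : (does (v ≟ v′) ∧ adj H i j) ≡ true → inj₂ (v , i) ∼ inj₂ (v′ , j)
      forth e with refl ← to (does≡true⇔ (v ≟ v′)) (∧-conicalˡ _ _ e) = copy (∧-conicalʳ _ _ e)

      back : inj₂ (v , i) ∼ inj₂ (v′ , j) → (does (v ≟ v′) ∧ adj H i j) ≡ true
      back (copy i∼j) = cong₂ _∧_ (dec-true (v ≟ v) refl) i∼j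

  Adj-encode⇔ : ∀ s t → Adj (corona G H) (encode s) (encode t) ⇔ s ∼ t
  Adj-encode⇔ s t = subst₂ (λ s′ t′ → Adj (corona G H) (encode s) (encode t) ⇔ s′ ∼ t′)
                           (decode-encode s) (decode-encode t) (Adj⇔∼ (encode s) (encode t))

  deg-root : ∀ v → deg G v + n H ≤ deg (corona G H) (encode (inj₁ v))
  deg-root v = begin
    deg G v + n H                        ≡⟨ cong (_+ n H) roots ⟨
    count p rootList + n H               ≤⟨ +-monoʳ-≤ _ copies ⟩
    count p rootList + count p copyList  ≡⟨ count-tabulate-+ (n G) p id ⟨
    deg (corona G H) (encode (inj₁ v))   ∎
    where
    open ≤-Reasoning
    p : Fin (n (corona G H)) → Bool
    p = adj (corona G H) (encode (inj₁ v))

    rootList copyList : List (Fin (n (corona G H)))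
    rootList = tabulate (_↑ˡ (n G * n H))
    copyList = tabulate (n G ↑ʳ_)

    roots : count p rootList ≡ deg G v
    roots = count-tabulate-cong _ id λ u → ⇔-sym base⇔ ⇔-∘ Adj-encode⇔ (inj₁ v) (inj₁ u)

    copies : n H ≤ count p copyList
    copies = ≤-trans
      (injective⇒≤-count (p ∘ (n G ↑ʳ_)) (combine v) (λ {i} {j} → combine-injectiveʳ v i v j)
                         λ j → from (Adj-encode⇔ (inj₁ v) (inj₂ (v , j))) spoke)
      (≤-reflexive (count-tabulate-cong {q = p} id (n G ↑ʳ_) λ _ → ⇔-id _))

  Δ-corona : 0 < n G → Δ G + n H ≤ Δ (corona G H)
  Δ-corona 0<nG with v , Δ≤deg ← Δ-attained G 0<nG =
    ≤-trans (+-monoˡ-≤ (n H) Δ≤deg) (≤-trans (deg-root v) (deg≤Δ (corona G H) _))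

-- σ p renames a and b to the new colors f₀ and f₁ and embeds the remaining m colors
-- into Fin (suc m) avoiding p.
module FreshPair {m : ℕ} {F : Set} {a b : Fin (suc (suc m))} (a≢b : a ≢ b)
                 {f₀ f₁ : F} (f₀≢f₁ : f₀ ≢ f₁) where

  data Position (x : Fin (suc (suc m))) : Set where
    at-a      : x ≡ a → Position x
    at-b      : x ≡ b → Position x
    elsewhere : x ≢ a → x ≢ b → Position x

  position : ∀ x → Position x
  position x with x ≟ a | x ≟ b
  ... | yes x≡a | _       = at-a x≡a
  ... | no x≢a  | yes x≡b = at-b x≡b
  ... | no x≢a  | no x≢b  = elsewhere x≢a x≢b

  squeeze : ∀ {x} → x ≢ a → x ≢ b → Fin m
  squeeze x≢a x≢b = punchOut {i = punchOut a≢b} (x≢b ∘ sym ∘ punchOut-injective a≢b (x≢a ∘ sym))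

  squeeze-injective : ∀ {x y} (x≢a : x ≢ a) x≢b (y≢a : y ≢ a) y≢b →
                      squeeze x≢a x≢b ≡ squeeze y≢a y≢b → x ≡ y
  squeeze-injective x≢a _ y≢a _ =
    punchOut-injective (x≢a ∘ sym) (y≢a ∘ sym) ∘ punchOut-injective {i = punchOut a≢b} _ _

  place : Fin (suc m) → ∀ {x} → Position x → Fin (suc m) ⊎ F
  place p (at-a _)            = inj₂ f₀
  place p (at-b _)            = inj₂ f₁
  place p (elsewhere x≢a x≢b) = inj₁ (punchIn p (squeeze x≢a x≢b))

  σ : Fin (suc m) → Fin (suc (suc m)) → Fin (suc m) ⊎ F
  σ p x = place p (position x)

  place-injective : ∀ p {x y} (px : Position x) (py : Position y) → place p px ≡ place p py → x ≡ y
  place-injective p (at-a refl) (at-a refl) _ = refl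
  place-injective p (at-a refl) (at-b refl) e = ⊥-elim (f₀≢f₁ (inj₂-injective e))
  place-injective p (at-b refl) (at-a refl) e = ⊥-elim (f₀≢f₁ (sym (inj₂-injective e)))
  place-injective p (at-b refl) (at-b refl) _ = refl
  place-injective p (elsewhere x≢a x≢b) (elsewhere y≢a y≢b) e =
    squeeze-injective x≢a x≢b y≢a y≢b (punchIn-injective p _ _ (inj₁-injective e))

  σ-injective : ∀ p {x y} → σ p x ≡ σ p y → x ≡ y
  σ-injective p {x} {y} = place-injective p (position x) (position y)

  σ≢inj₁ : ∀ p x → σ p x ≢ inj₁ p
  σ≢inj₁ p x = place≢ (position x)
    where
    place≢ : ∀ {x} (px : Position x) → place p px ≢ inj₁ p
    place≢ (elsewhere _ _) = punchInᵢ≢i p _ ∘ inj₁-injective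

  σ≡inj₂ : ∀ p x {f} → σ p x ≡ inj₂ f → f ≡ f₀ ⊎ f ≡ f₁
  σ≡inj₂ p x = place≡ (position x)
    where
    place≡ : ∀ {x f} (px : Position x) → place p px ≡ inj₂ f → f ≡ f₀ ⊎ f ≡ f₁
    place≡ (at-a _) refl = inj₁ refl
    place≡ (at-b _) refl = inj₂ refl

  σ-a : ∀ p → σ p a ≡ inj₂ f₀
  σ-a p with position a
  ... | at-a _          = refl
  ... | at-b a≡b        = ⊥-elim (a≢b a≡b)
  ... | elsewhere a≢a _ = ⊥-elim (a≢a refl)

  σ-b : ∀ p → σ p b ≡ inj₂ f₁
  σ-b p with position b
  ... | at-a b≡a        = ⊥-elim (a≢b (sym b≡a))
  ... | at-b _          = refl
  ... | elsewhere _ b≢b = ⊥-elim (b≢b refl)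

  f₀-preimage : ∀ p {x} → inj₂ f₀ ≡ σ p x ⇔ x ≡ a
  f₀-preimage p = mk⇔ (λ f₀≡ → sym (σ-injective p (trans (σ-a p) f₀≡))) λ { refl → sym (σ-a p) }

  f₁-preimage : ∀ p {x} → inj₂ f₁ ≡ σ p x ⇔ x ≡ b
  f₁-preimage p = mk⇔ (λ f₁≡ → sym (σ-injective p (trans (σ-b p) f₁≡))) λ { refl → sym (σ-b p) }

module CoronaColoring (G H : Graph) {m : ℕ}
  {vcG : Fin (n G) → Fin (suc m)} {ecG : Fin (n G) → Fin (n G) → Fin (suc m)}
  (G-avd : IsAVD (Adj G) vcG ecG)
  {vcH : Fin (n H) → Fin (suc (suc m))} {ecH : Fin (n H) → Fin (n H) → Fin (suc (suc m))}
  (H-proper : IsProper (Adj H) vcH ecH)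
  {j₀ j₁ : Fin (n H)} (j₀≢j₁ : j₀ ≢ j₁)
  (sep : SeparatingPair (ColorSet (Adj H) vcH ecH j₀) (ColorSet (Adj H) vcH ecH j₁))
  where

  open Corona G H
  open SeparatingPair sep
  open FreshPair a≢b j₀≢j₁
  module G′ = Proper (proj₁ G-avd)
  module H′ = Proper H-proper

  CG = ColorSet (Adj G) vcG ecG
  CH = ColorSet (Adj H) vcH ecH

  vc : Vertex → Fin (suc m) ⊎ Fin (n H)
  vc (inj₁ v)       = inj₁ (vcG v)
  vc (inj₂ (v , j)) = σ (vcG v) (vcH j)

  ec : Vertex → Vertex → Fin (suc m) ⊎ Fin (n H)
  ec (inj₁ u)       (inj₁ w)        = inj₁ (ecG u w)
  ec (inj₁ _)       (inj₂ (_ , j))  = inj₂ j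
  ec (inj₂ (_ , j)) (inj₁ _)        = inj₂ j
  ec (inj₂ (v , i)) (inj₂ (_ , j))  = σ (vcG v) (ecH i j)

  C = ColorSet _∼_ vc ec
  Same = SameColors _∼_ vc ec

  Same-sym : ∀ {s t} → Same s t → Same t s
  Same-sym same c = ⇔-sym (same c)

  σ≢spoke : ∀ p {j x} → CH j x → σ p x ≢ inj₂ j
  σ≢spoke p {x = x} x∈ σx≡ with σ≡inj₂ p x σx≡
  ... | inj₁ refl = a∉S (subst (CH j₀) (σ-injective p (trans σx≡ (sym (σ-a p)))) x∈)
  ... | inj₂ refl = b∉T (subst (CH j₁) (σ-injective p (trans σx≡ (sym (σ-b p)))) x∈)

  ec-sym : ∀ s t → s ∼ t → ec s t ≡ ec t s
  ec-sym _ _ (base u∼w) = cong inj₁ (G′.ec-sym _ _ u∼w)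
  ec-sym _ _ spoke      = refl
  ec-sym _ _ spoke˘     = refl
  ec-sym _ _ (copy i∼j) = cong (σ _) (H′.ec-sym _ _ i∼j)

  vc-distinct : ∀ s t → s ∼ t → vc s ≢ vc t
  vc-distinct _ _ (base u∼w) = G′.vc-distinct _ _ u∼w ∘ inj₁-injective
  vc-distinct _ _ spoke      = σ≢inj₁ _ _ ∘ sym
  vc-distinct _ _ spoke˘     = σ≢inj₁ _ _
  vc-distinct _ _ (copy i∼j) = H′.vc-distinct _ _ i∼j ∘ σ-injective _

  ec-distinct : ∀ s t r → s ∼ t → s ∼ r → t ≢ r → ec s t ≢ ec s r
  ec-distinct _ _ _ (base u∼w) (base u∼w′) w≢w′ =
    G′.ec-distinct _ _ _ u∼w u∼w′ (w≢w′ ∘ cong inj₁) ∘ inj₁-injective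
  ec-distinct _ _ _ (base _)   spoke       _    = λ ()
  ec-distinct _ _ _ spoke      (base _)    _    = λ ()
  ec-distinct _ _ _ spoke      spoke       t≢r  = t≢r ∘ cong (λ j → inj₂ (_ , j)) ∘ inj₂-injective
  ec-distinct _ _ _ spoke˘     spoke˘      t≢r  = ⊥-elim (t≢r refl)
  ec-distinct _ _ _ spoke˘     (copy j∼l)  _    = σ≢spoke _ (inj₂ (_ , j∼l , refl)) ∘ sym
  ec-distinct _ _ _ (copy j∼l) spoke˘      _    = σ≢spoke _ (inj₂ (_ , j∼l , refl))
  ec-distinct _ _ _ (copy i∼j) (copy i∼l)  t≢r  =
    H′.ec-distinct _ _ _ i∼j i∼l (t≢r ∘ cong (λ j → inj₂ (_ , j))) ∘ σ-injective _

  ec≢vc : ∀ s t → s ∼ t → ec s t ≢ vc s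
  ec≢vc _ _ (base u∼w) = G′.ec≢vc _ _ u∼w ∘ inj₁-injective
  ec≢vc _ _ spoke      = λ ()
  ec≢vc _ _ spoke˘     = σ≢spoke _ (inj₁ refl) ∘ sym
  ec≢vc _ _ (copy i∼j) = H′.ec≢vc _ _ i∼j ∘ σ-injective _

  root-colors : ∀ {u c} → CG u c ⇔ C (inj₁ u) (inj₁ c)
  root-colors {u} = mk⇔ forth back
    where
    forth : ∀ {c} → CG u c → C (inj₁ u) (inj₁ c)
    forth (inj₁ refl)             = inj₁ refl
    forth (inj₂ (w , u∼w , refl)) = inj₂ (inj₁ w , base u∼w , refl)

    back : ∀ {c} → C (inj₁ u) (inj₁ c) → CG u c
    back (inj₁ refl)                       = inj₁ refl
    back (inj₂ (inj₁ w , base u∼w , refl)) = inj₂ (w , u∼w , refl)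

  root-color∉copy : ∀ {v j} → ¬ C (inj₂ (v , j)) (inj₁ (vcG v))
  root-color∉copy (inj₁ σ≡)                = σ≢inj₁ _ _ σ≡
  root-color∉copy (inj₂ (_ , copy _ , σ≡)) = σ≢inj₁ _ _ σ≡

  spoke∈copy : ∀ {v j} → C (inj₂ (v , j)) (inj₂ j)
  spoke∈copy = inj₂ (inj₁ _ , spoke˘ , refl)

  fresh∈copy : ∀ {v i j} → C (inj₂ (v , j)) (inj₂ i) → i ≡ j ⊎ (i ≡ j₀ ⊎ i ≡ j₁)
  fresh∈copy (inj₁ σ≡)                  = inj₂ (σ≡inj₂ _ _ σ≡)
  fresh∈copy (inj₂ (_ , spoke˘ , refl)) = inj₁ refl
  fresh∈copy (inj₂ (_ , copy _ , σ≡))   = inj₂ (σ≡inj₂ _ _ σ≡)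

  copy-colors : ∀ {v j x} → C (inj₂ (v , j)) (σ (vcG v) x) ⇔ (CH j x ⊎ inj₂ j ≡ σ (vcG v) x)
  copy-colors {v} {j} = mk⇔ forth back
    where
    forth : ∀ {x} → C (inj₂ (v , j)) (σ (vcG v) x) → CH j x ⊎ inj₂ j ≡ σ (vcG v) x
    forth (inj₁ σ≡)                   = inj₁ (inj₁ (σ-injective _ σ≡))
    forth (inj₂ (_ , spoke˘ , spoke≡)) = inj₂ spoke≡
    forth (inj₂ (_ , copy j∼l , σ≡))   = inj₁ (inj₂ (_ , j∼l , σ-injective _ σ≡))

    back : ∀ {x} → CH j x ⊎ inj₂ j ≡ σ (vcG v) x → C (inj₂ (v , j)) (σ (vcG v) x)
    back (inj₁ (inj₁ refl))             = inj₁ refl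
    back (inj₁ (inj₂ (l , j∼l , refl))) = inj₂ (inj₂ (v , l) , copy j∼l , refl)
    back (inj₂ spoke≡)                  = inj₂ (inj₁ v , spoke˘ , spoke≡)

  copy₀-colors : ∀ {v x} → C (inj₂ (v , j₀)) (σ (vcG v) x) ⇔ (CH j₀ x ⊎ x ≡ a)
  copy₀-colors = (⇔-id _ ⊎-⇔ f₀-preimage _) ⇔-∘ copy-colors

  copy₁-colors : ∀ {v x} → C (inj₂ (v , j₁)) (σ (vcG v) x) ⇔ (CH j₁ x ⊎ x ≡ b)
  copy₁-colors = (⇔-id _ ⊎-⇔ f₁-preimage _) ⇔-∘ copy-colors

  spoke-separates : ∀ {v i j} → i ≢ j → ¬ (i ≡ j₀ ⊎ i ≡ j₁) → ¬ Same (inj₂ (v , i)) (inj₂ (v , j))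
  spoke-separates i≢j i∉ same = [ i≢j , i∉ ]′ (fresh∈copy (to (same _) spoke∈copy))

  pair-separated : ∀ {v} → ¬ Same (inj₂ (v , j₀)) (inj₂ (v , j₁))
  pair-separated {v} same = apart λ x → copy₁-colors ⇔-∘ (same (σ (vcG v) x) ⇔-∘ ⇔-sym copy₀-colors)

  copies-separated : ∀ {v i j} → Adj H i j → ¬ Same (inj₂ (v , i)) (inj₂ (v , j))
  copies-separated {i = i} {j} i∼j with i ≟ j₀ ⊎-dec i ≟ j₁ | j ≟ j₀ ⊎-dec j ≟ j₁
  ... | no i∉           | _               = spoke-separates (H′.∼⇒≢ i∼j) i∉
  ... | yes _           | no j∉           = spoke-separates (H′.∼⇒≢ i∼j ∘ sym) j∉ ∘ Same-sym
  ... | yes (inj₁ refl) | yes (inj₁ refl) = ⊥-elim (H′.∼⇒≢ i∼j refl)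
  ... | yes (inj₁ refl) | yes (inj₂ refl) = pair-separated
  ... | yes (inj₂ refl) | yes (inj₁ refl) = pair-separated ∘ Same-sym
  ... | yes (inj₂ refl) | yes (inj₂ refl) = ⊥-elim (H′.∼⇒≢ i∼j refl)

  separated : ∀ s t → s ∼ t → ¬ Same s t
  separated _ _ (base u∼w) same =
    proj₂ G-avd _ _ u∼w λ c → ⇔-sym root-colors ⇔-∘ (same (inj₁ c) ⇔-∘ root-colors)
  separated _ _ spoke      = ¬∀⇔ _ (inj₁ refl) root-color∉copy
  separated _ _ spoke˘     = ¬∀⇔ _ (inj₁ refl) root-color∉copy ∘ Same-sym
  separated _ _ (copy i∼j) = copies-separated i∼j

  avd : IsAVD _∼_ vc ec
  avd = (ec-sym , vc-distinct , ec-distinct , ec≢vc) , separated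

  coloring : HasAVDTotalColoring (corona G H) (suc m + n H)
  coloring = HasAVD-relabel (corona G H) vertex↔ Adj⇔∼ (λ {x} {y} → join-injective x y) avd
    where
    join-injective : ∀ x y → join (suc m) (n H) x ≡ join (suc m) (n H) y → x ≡ y
    join-injective x y e =
      trans (sym (splitAt-join (suc m) (n H) x)) (trans (cong (splitAt (suc m)) e) (splitAt-join (suc m) (n H) y))

two-distinct : ∀ {N} → 2 ≤ N → Σ (Fin N) λ i → Σ (Fin N) λ j → i ≢ j
two-distinct (s≤s (s≤s _)) = zero , suc zero , λ ()

theorem3 : (G H : Graph) →
    IsSimple G → IsSimple H → Connected G → Connected H →
    2 ≤ n G → 2 ≤ n H →
    χa≤ G (Δ G + 3) → χa≤ H (Δ H + 3) →
    Δ H ≡ suc (Δ G) →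
    χa≤ (corona G H) (Δ (corona G H) + 3)
theorem3 G H _ _ _ _ 2≤nG 2≤nH χG χH ΔH≡1+ΔG
  with mkTC vcG ecG , G-avd ← χa≤⇒HasAVD χG (≤-reflexive (+-comm (Δ G) 3))
     | mkTC vcH ecH , H-avd ← χa≤⇒HasAVD χH (≤-reflexive (trans (cong (_+ 3) ΔH≡1+ΔG) (+-comm _ 3)))
     | j₀ , j₁ , j₀≢j₁ ← two-distinct 2≤nH
  = 3 + Δ G + n H , colors-fit ,
    CoronaColoring.coloring G H G-avd (proj₁ H-avd) j₀≢j₁
      (missing-colors-separate H vcH ecH (room j₀) (room j₁))
  where
  room : ∀ j → suc (suc (deg H j)) < 4 + Δ G
  room j = s≤s (s≤s (s≤s (subst (deg H j ≤_) ΔH≡1+ΔG (deg≤Δ H j))))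

  colors-fit : 3 + Δ G + n H ≤ Δ (corona G H) + 3
  colors-fit = ≤-trans (+-monoʳ-≤ 3 (Corona.Δ-corona G H (≤-trans (s≤s z≤n) 2≤nG)))
                       (≤-reflexive (+-comm 3 _))
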